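{- Let $S\subseteq\omega$ and let $\phi$ be a formula of $\mathcal{L}_S$. Then $\mathsf{J}_\omega\vdash\phi$ if and only if $\mathsf{J}_S\vdash\phi$.
   Context: $\mathcal{L}_\omega$ is the propositional modal language with countably many variables, $\top$, $\neg,\wedge$ and modalities $[n]$, $n<\omega$; $\langle n\rangle:=\neg[n]\neg$; for $S\subseteq\omega$, $\mathcal{L}_S$ uses only modalities $[n]$ with $n\in S$. $\mathsf{J}_\omega$ is axiomatized by all substitution instances of propositional tautologies and, for all $\alpha,\beta<\omega$: $[\alpha](\chi\to\psi)\to([\alpha]\chi\to[\alpha]\psi)$; $[\alpha]([\alpha]\chi\to\chi)\to[\alpha]\chi$; $[\alpha]\chi\to[\beta][\alpha]\chi$ for $\alpha\le\beta$; $\langle\alpha\rangle\chi\to[\beta]\langle\alpha\rangle\chi$ for $\alpha<\beta$; $[\alpha]\chi\to[\alpha][\beta]\chi$ for $\alpha\le\beta$; with modus ponens and necessitation $\chi/[\alpha]\chi$. $\mathsf{J}_S$ is the restriction of these axioms and rules to the language $\mathcal{L}_S$. -}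

module Defs where

open import Data.Nat using (ℕ; _≤_; _<_)
open import Data.Bool using (Bool; true; false; not; _∧_)
open import Data.Unit using (⊤)
open import Data.Product using (_×_)
open import Relation.Binary.PropositionalEquality using (_≡_)

data Fm : Set where
  var  : ℕ → Fm
  top  : Fm
  neg  : Fm → Fm
  _and_ : Fm → Fm → Fm
  box  : ℕ → Fm → Fm

infixr 6 _and_
infixr 4 _⇒_

_⇒_ : Fm → Fm → Fm
φ ⇒ ψ = neg (φ and neg ψ)

dia : ℕ → Fm → Fm
dia n φ = neg (box n (neg φ))

Subset : Set₁
Subset = ℕ → Set

data InL (S : Subset) : Fm → Set where
  var  : ∀ i → InL S (var i)
  top  : InL S top
  neg  : ∀ {φ} → InL S φ → InL S (neg φ)
  and′ : ∀ {φ ψ} → InL S φ → InL S ψ → InL S (φ and ψ)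
  box  : ∀ {n φ} → S n → InL S φ → InL S (box n φ)

-- Boolean evaluation of the propositional skeleton: variables and boxed
-- subformulas are the propositional atoms, valued by v.
eval : (Fm → Bool) → Fm → Bool
eval v (var i)   = v (var i)
eval v top       = true
eval v (neg φ)   = not (eval v φ)
eval v (φ and ψ) = eval v φ ∧ eval v ψ
eval v (box n φ) = v (box n φ)

-- φ is a substitution instance of a propositional tautology.
Taut : Fm → Set
Taut φ = ∀ (v : Fm → Bool) → eval v φ ≡ true

data J (S : Subset) : Fm → Set where
  taut : ∀ {φ} → InL S φ → Taut φ → J S φ
  axK  : ∀ {a χ ψ} → S a → InL S χ → InL S ψ →
         J S (box a (χ ⇒ ψ) ⇒ (box a χ ⇒ box a ψ))
  axL  : ∀ {a χ} → S a → InL S χ →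
         J S (box a (box a χ ⇒ χ) ⇒ box a χ)
  ax3  : ∀ {a b χ} → S a → S b → a ≤ b → InL S χ →
         J S (box a χ ⇒ box b (box a χ))
  ax4  : ∀ {a b χ} → S a → S b → a < b → InL S χ →
         J S (dia a χ ⇒ box b (dia a χ))
  ax5  : ∀ {a b χ} → S a → S b → a ≤ b → InL S χ →
         J S (box a χ ⇒ box a (box b χ))
  mp   : ∀ {φ ψ} → J S (φ ⇒ ψ) → J S φ → J S ψ
  nec  : ∀ {a φ} → S a → J S φ → J S (box a φ)

ω : Subset
ω _ = ⊤

module Submission where

-- The translation that deletes every modality outside a decidable set P
-- (replacing [n]χ by ⊤ when n ∉ P) maps the axioms of any J_T to theorems
-- of J_P and commutes with the rules, so it turns derivations into
-- derivations of J_P, and it fixes formulas of L_P.  As S need not be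
-- decidable, take for P the finitely many modalities of φ, which lie in S:
-- this gives J_ω ⊢ φ ⇒ J_S ⊢ φ; the converse is monotonicity of J in S.

open import Defs
open import Data.Bool using (true; false; not; _∧_)
open import Data.Nat using (ℕ; _≟_)
open import Data.List using (List; []; _∷_; _++_)
open import Data.List.Membership.Propositional using (_∈_)
open import Data.List.Membership.Propositional.Properties using (∈-++⁺ˡ; ∈-++⁺ʳ; ∈-++⁻)
open import Data.List.Membership.DecPropositional _≟_ using (_∈?_)
open import Data.List.Relation.Unary.Any using (here; there)
open import Data.Sum using ([_,_]′)
open import Data.Unit using (tt)
open import Function using (_∘_)
open import Function.Bundles using (_⇔_; mk⇔)
open import Relation.Binary.PropositionalEquality using (_≡_; refl; trans; cong; cong₂; subst)
open import Relation.Nullary using (Dec; yes; no; contradiction)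
open import Relation.Unary using (_⊆_; Decidable)

InL-mono : ∀ {S T φ} → S ⊆ T → InL S φ → InL T φ
InL-mono S⊆T (var i)    = var i
InL-mono S⊆T top        = top
InL-mono S⊆T (neg p)    = neg (InL-mono S⊆T p)
InL-mono S⊆T (and′ p q) = and′ (InL-mono S⊆T p) (InL-mono S⊆T q)
InL-mono S⊆T (box s p)  = box (S⊆T s) (InL-mono S⊆T p)

J-mono : ∀ {S T φ} → S ⊆ T → J S φ → J T φ
J-mono S⊆T (taut p t)      = taut (InL-mono S⊆T p) t
J-mono S⊆T (axK a p q)     = axK (S⊆T a) (InL-mono S⊆T p) (InL-mono S⊆T q)
J-mono S⊆T (axL a p)       = axL (S⊆T a) (InL-mono S⊆T p)
J-mono S⊆T (ax3 a b a≤b p) = ax3 (S⊆T a) (S⊆T b) a≤b (InL-mono S⊆T p)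
J-mono S⊆T (ax4 a b a<b p) = ax4 (S⊆T a) (S⊆T b) a<b (InL-mono S⊆T p)
J-mono S⊆T (ax5 a b a≤b p) = ax5 (S⊆T a) (S⊆T b) a≤b (InL-mono S⊆T p)
J-mono S⊆T (mp d e)        = mp (J-mono S⊆T d) (J-mono S⊆T e)
J-mono S⊆T (nec a d)       = nec (S⊆T a) (J-mono S⊆T d)

modalities : Fm → List ℕ
modalities (var i)   = []
modalities top       = []
modalities (neg φ)   = modalities φ
modalities (φ and ψ) = modalities φ ++ modalities ψ
modalities (box n φ) = n ∷ modalities φ

InL-modalities : ∀ φ → InL (_∈ modalities φ) φ
InL-modalities (var i)   = var i
InL-modalities top       = top
InL-modalities (neg φ)   = neg (InL-modalities φ)
InL-modalities (φ and ψ) =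
  and′ (InL-mono ∈-++⁺ˡ (InL-modalities φ))
       (InL-mono (∈-++⁺ʳ (modalities φ)) (InL-modalities ψ))
InL-modalities (box n φ) = box (here refl) (InL-mono there (InL-modalities φ))

modalities-⊆ : ∀ {S φ} → InL S φ → (_∈ modalities φ) ⊆ S
modalities-⊆ (var i)                = λ ()
modalities-⊆ top                    = λ ()
modalities-⊆ (neg p)                = modalities-⊆ p
modalities-⊆ (and′ {φ} p q)         = [ modalities-⊆ p , modalities-⊆ q ]′ ∘ ∈-++⁻ (modalities φ)
modalities-⊆ (box s p) (here refl)  = s
modalities-⊆ (box s p) (there n∈φ) = modalities-⊆ p n∈φ

⊢⊤ : ∀ {S} → J S top
⊢⊤ = taut top (λ v → refl)

⊢-const : ∀ {S φ ψ} → InL S φ → InL S ψ → J S ψ → J S (φ ⇒ ψ)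
⊢-const {φ = φ} {ψ} p q ⊢ψ = mp (taut (neg (and′ q (neg (neg (and′ p (neg q)))))) tautology) ⊢ψ
  where
  tautology : Taut (ψ ⇒ φ ⇒ ψ)
  tautology v with eval v ψ | eval v φ
  ... | false | _     = refl
  ... | true  | false = refl
  ... | true  | true  = refl

⊢-⇒⊤ : ∀ {S φ} → InL S φ → J S (φ ⇒ top)
⊢-⇒⊤ p = ⊢-const p top ⊢⊤

⊢-⊥⇒ : ∀ {S φ} → InL S φ → J S (neg top ⇒ φ)
⊢-⊥⇒ p = taut (neg (and′ (neg top) (neg p))) (λ v → refl)

module Erasure {P : Subset} (P? : Decidable P) where

  box-if : ∀ {n} → Dec (P n) → Fm → Fm
  box-if {n} (yes _) φ = box n φ
  box-if     (no _)  φ = top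

  erase : Fm → Fm
  erase (var i)   = var i
  erase top       = top
  erase (neg φ)   = neg (erase φ)
  erase (φ and ψ) = erase φ and erase ψ
  erase (box n φ) = box-if (P? n) (erase φ)

  InL-erase : ∀ φ → InL P (erase φ)
  InL-erase (var i)   = var i
  InL-erase top       = top
  InL-erase (neg φ)   = neg (InL-erase φ)
  InL-erase (φ and ψ) = and′ (InL-erase φ) (InL-erase ψ)
  InL-erase (box n φ) with P? n
  ... | yes n∈P = box n∈P (InL-erase φ)
  ... | no _    = top

  erase-fixes : ∀ {φ} → InL P φ → erase φ ≡ φ
  erase-fixes (var i)    = refl
  erase-fixes top        = refl
  erase-fixes (neg p)    = cong neg (erase-fixes p)
  erase-fixes (and′ p q) = cong₂ _and_ (erase-fixes p) (erase-fixes q)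
  erase-fixes (box {n} n∈P p) with P? n
  ... | yes _   = cong (box n) (erase-fixes p)
  ... | no n∉P  = contradiction n∈P n∉P

  -- Boxed subformulas are atoms for eval, so erase is a substitution.
  eval-erase : ∀ v φ → eval v (erase φ) ≡ eval (eval v ∘ erase) φ
  eval-erase v (var i)   = refl
  eval-erase v top       = refl
  eval-erase v (neg φ)   = cong not (eval-erase v φ)
  eval-erase v (φ and ψ) = cong₂ _∧_ (eval-erase v φ) (eval-erase v ψ)
  eval-erase v (box n φ) = refl

  Taut-erase : ∀ {φ} → Taut φ → Taut (erase φ)
  Taut-erase {φ} t v = trans (eval-erase v φ) (t (eval v ∘ erase))

  erase-sound : ∀ {T φ} → J T φ → J P (erase φ)
  erase-sound (taut {φ} _ t) = taut (InL-erase φ) (Taut-erase {φ} t)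
  erase-sound (axK {a} {χ} {ψ} _ _ _) with P? a
  ... | yes a∈P = axK a∈P (InL-erase χ) (InL-erase ψ)
  ... | no _    = ⊢-const top (neg (and′ top (neg top))) (⊢-⇒⊤ top)
  erase-sound (axL {a} {χ} _ _) with P? a
  ... | yes a∈P = axL a∈P (InL-erase χ)
  ... | no _    = ⊢-⇒⊤ top
  erase-sound (ax3 {a} {b} {χ} _ _ a≤b _) with P? a | P? b
  ... | yes a∈P | yes b∈P = ax3 a∈P b∈P a≤b (InL-erase χ)
  ... | yes a∈P | no _    = ⊢-⇒⊤ (box a∈P (InL-erase χ))
  ... | no _    | yes b∈P = ⊢-const top (box b∈P top) (nec b∈P ⊢⊤)
  ... | no _    | no _    = ⊢-⇒⊤ top
  erase-sound (ax4 {a} {b} {χ} _ _ a<b _) with P? a | P? b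
  ... | yes a∈P | yes b∈P = ax4 a∈P b∈P a<b (InL-erase χ)
  ... | yes a∈P | no _    = ⊢-⇒⊤ (neg (box a∈P (neg (InL-erase χ))))
  ... | no _    | yes b∈P = ⊢-⊥⇒ (box b∈P (neg top))
  ... | no _    | no _    = ⊢-⇒⊤ (neg top)
  erase-sound (ax5 {a} {b} {χ} _ _ a≤b _) with P? a | P? b
  ... | yes a∈P | yes b∈P = ax5 a∈P b∈P a≤b (InL-erase χ)
  ... | yes a∈P | no _    = ⊢-const (box a∈P (InL-erase χ)) (box a∈P top) (nec a∈P ⊢⊤)
  ... | no _    | _       = ⊢-⇒⊤ top
  erase-sound (mp d e) = mp (erase-sound d) (erase-sound e)
  erase-sound (nec {a} _ d) with P? a
  ... | yes a∈P = nec a∈P (erase-sound d)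
  ... | no _    = ⊢⊤

conservative : ∀ {S T φ} → InL S φ → J T φ → J S φ
conservative {S} {T} {φ} p d =
  subst (J S) (erase-fixes (InL-modalities φ)) (J-mono (modalities-⊆ p) (erase-sound d))
  where open Erasure (_∈? modalities φ)

mainTheorem10 : (S : Subset) (φ : Fm) → InL S φ → (J ω φ ⇔ J S φ)
mainTheorem10 S φ p = mk⇔ (conservative p) (J-mono (λ _ → tt))
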